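{- Let $C: a_1x_1+\cdots+a_{n-1}x_{n-1}\leqslant a_0$ be a linear integer constraint with positive integer coefficients, integer $a_0\ge 0$, and integer variables $x_i\in[0,d_i]$, and let $b>1$ be an integer. Let $m$ be the least nonnegative integer with $a_0<b^{m+1}$, and assume $a_i<b^{m+1}$ for all $1\le i\le n-1$. The SN-Tare encoding of $C$ described in the context is consistent: for all integers $0\le l_i\le u_i\le d_i$ ($1\le i\le n-1$), if no integer vector $(w_1,\dots,w_{n-1})$ with $l_i\le w_i\le u_i$ satisfies $C$, then unit propagation on the encoding together with the literals $x_i^k$ (for $1\le k\le l_i$) and $\neg x_i^k$ (for $u_i<k\le d_i$) derives a conflict.
   Context: SN-Tare encoding. Set $a_n=b^{m+1}-1-a_0$ and introduce a tare variable $x_n\in[0,1]$; write $a_i=\sum_{j=0}^m b^jA_{i,j}$ with $0\le A_{i,j}<b$ for $1\le i\le n$. Order encoding: Boolean variables $x_i^k$ ($1\le k\le d_i$, with $d_n=1$) meaning $x_i\ge k$, with clauses $x_i^{k+1}\rightarrow x_i^k$. Sorting network encoding $\mathrm{sn}$: for a list of literals $u_1,\dots,u_N$ (repetitions allowed), $\mathrm{sn}(u_1,\dots,u_N)$ introduces outputs $w_1,\dots,w_N$ and a CNF formula such that in every satisfying assignment $w_k$ is true iff at least $k$ inputs are true, and unit propagation on it is domain consistent for the relation $\{(u,w)\in\{0,1\}^{2N}: w_k=1\iff|\{l:u_l=1\}|\ge k\}$. Let $X_{i,j}$ be the list $x_i^1$ repeated $A_{i,j}$ times, then $x_i^2$ repeated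 $A_{i,j}$ times, ..., then $x_i^{d_i}$ repeated $A_{i,j}$ times. Define $(y_0^1,\dots,y_0^{N_0})=\mathrm{sn}(X_{1,0},\dots,X_{n,0})$ and for $1\le j\le m$: $(y_j^1,\dots,y_j^{N_j})=\mathrm{sn}(y_{j-1}^b,y_{j-1}^{2b},\dots,y_{j-1}^{b\lfloor N_{j-1}/b\rfloor},X_{1,j},\dots,X_{n,j})$. The encoding consists of the order-encoding clauses, the clauses of these networks, and the unit clauses $x_n^1$ and $\neg y_m^b$ (the latter omitted if $N_m<b$). -}

module Defs where

open import Data.Nat using (ℕ; zero; suc; _+_; _*_; _∸_; _^_; _≤_; _<_; _≡ᵇ_)
open import Data.Nat.DivMod using (_/_; _%_)
open import Data.Bool using (Bool; true; false; if_then_else_)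
open import Data.List using (List; []; _∷_; _++_; map; concatMap; replicate; upTo; length)
open import Data.Nat.ListAction using (sum)
open import Data.List.Membership.Propositional using (_∈_)
open import Data.Maybe using (Maybe; just; nothing)
open import Data.Product using (_×_; _,_; ∃; ∃-syntax; Σ)
open import Relation.Binary.PropositionalEquality using (_≡_; _≢_)
open import Relation.Nullary using (¬_)
open import Data.Empty using (⊥)
open import Data.Sum using (_⊎_)

-- Variables: order-encoding variables  ord i k  (meaning x_i ≥ k) and
-- auxiliary variables  aux t  (introduced by the sorting networks).
data Var : Set where
  ord : ℕ → ℕ → Var
  aux : ℕ → Var

data Lit : Set where
  pos : Var → Lit
  neg : Var → Lit

negate : Lit → Lit
negate (pos v) = neg v
negate (neg v) = pos v

litVar : Lit → Var
litVar (pos v) = v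
litVar (neg v) = v

Clause : Set
Clause = List Lit

CNF : Set
CNF = List Clause

unit : Lit → Clause
unit l = l ∷ []

units : List Lit → CNF
units = map unit

data Derives (F : CNF) : Lit → Set where
  prop : ∀ {c l} → c ∈ F → l ∈ c →
         (∀ l' → l' ∈ c → l' ≢ l → Derives F (negate l')) →
         Derives F l

Conflict : CNF → Set
Conflict F = ∃[ c ] (c ∈ F × (∀ l → l ∈ c → Derives F (negate l)))

Assignment : Set
Assignment = Var → Bool

evalLit : Assignment → Lit → Bool
evalLit σ (pos v) = σ v
evalLit σ (neg v) = if σ v then false else true

SatClause : Assignment → Clause → Set
SatClause σ c = ∃[ l ] (l ∈ c × evalLit σ l ≡ true)

SatCNF : Assignment → CNF → Set
SatCNF σ F = ∀ c → c ∈ F → SatClause σ c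

SatLits : Assignment → List Lit → Set
SatLits σ ls = ∀ l → l ∈ ls → evalLit σ l ≡ true

countTrue : Assignment → List Lit → ℕ
countTrue σ [] = 0
countTrue σ (l ∷ ls) = (if evalLit σ l then 1 else 0) + countTrue σ ls

at : {A : Set} → ℕ → List A → Maybe A
at n [] = nothing
at zero (x ∷ xs) = just x
at (suc n) (x ∷ xs) = at n xs

-- The sorting relation on inputs us and outputs ws under σ:
-- w_k (1-indexed) is true iff at least k inputs are true.
SortRel : List Lit → List Var → Assignment → Set
SortRel us ws σ = ∀ k w → at k ws ≡ just w →
  (σ w ≡ true → suc k ≤ countTrue σ us) × (suc k ≤ countTrue σ us → σ w ≡ true)

-- sn us s = (ws , G , s') : outputs ws, clauses G, using fresh auxiliary
-- variables aux t with s ≤ t < s'.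
SNFun : Set
SNFun = List Lit → ℕ → List Var × CNF × ℕ

VarIn : Var → List Lit → Set
VarIn v ls = ∃[ l ] (l ∈ ls × litVar l ≡ v)

VarInCNF : Var → CNF → Set
VarInCNF v F = ∃[ c ] (c ∈ F × VarIn v c)

FreshIn : ℕ → ℕ → Var → Set
FreshIn s s' v = ∃[ t ] (v ≡ aux t × s ≤ t × t < s')

Distinct : {A : Set} → List A → Set
Distinct xs = ∀ i j x → at i xs ≡ just x → at j xs ≡ just x → i ≡ j

Interface : List Lit → List Var → Var → Set
Interface us ws v = VarIn v us ⊎ v ∈ ws

AllPos : List Lit → Set
AllPos us = ∀ l → l ∈ us → ∃[ v ] (l ≡ pos v)

-- Specification of a sorting network encoding, required for all lists
-- of positive input literals (the only inputs used by SN-Tare).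
record SNSpec (sn : SNFun) : Set where
  field
    outLength : ∀ us → AllPos us → ∀ s → let (ws , G , s') = sn us s in length ws ≡ length us
    freshBound : ∀ us → AllPos us → ∀ s → let (ws , G , s') = sn us s in s ≤ s'
    outFresh : ∀ us → AllPos us → ∀ s → let (ws , G , s') = sn us s in
      (∀ w → w ∈ ws → FreshIn s s' w) × Distinct ws
    clauseVars : ∀ us → AllPos us → ∀ s → let (ws , G , s') = sn us s in
      ∀ v → VarInCNF v G → VarIn v us ⊎ FreshIn s s' v
    sound : ∀ us → AllPos us → ∀ s → let (ws , G , s') = sn us s in
      ∀ σ → SatCNF σ G → SortRel us ws σ
    -- unit propagation is domain consistent for the sorting relation:
    -- for a partial assignment α on the interface variables, UP detects
    -- a conflict if α has no extension in the relation, and otherwise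
    -- derives every interface literal true in all such extensions.
    dcConflict : ∀ us → AllPos us → ∀ s → let (ws , G , s') = sn us s in
      ∀ (α : List Lit) → (∀ l → l ∈ α → Interface us ws (litVar l)) →
      (¬ (∃[ σ ] (SatLits σ α × SortRel us ws σ))) →
      Conflict (G ++ units α)
    dcPropagate : ∀ us → AllPos us → ∀ s → let (ws , G , s') = sn us s in
      ∀ (α : List Lit) → (∀ l → l ∈ α → Interface us ws (litVar l)) →
      ∀ (l : Lit) → Interface us ws (litVar l) →
      (∀ σ → SatLits σ α → SortRel us ws σ → evalLit σ l ≡ true) →
      Derives (G ++ units α) l

range1 : ℕ → List ℕ
range1 n = map suc (upTo n)

sumTo : ℕ → (ℕ → ℕ) → ℕ
sumTo n f = sum (map f (range1 n))

digit : (b a j : ℕ) → ℕ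
digit zero a j = 0
digit (suc b') a j = (a / (suc b' ^ j)) {{nz}} % suc b'
  where
  open import Data.Nat.Base using (NonZero)
  open import Data.Nat.Properties using (m^n≢0)
  nz : NonZero (suc b' ^ j)
  nz = m^n≢0 (suc b') j

-- positions b, 2b, 3b, ... (1-indexed) of a list
everyAux : {A : Set} → ℕ → ℕ → List A → List A
everyAux b c [] = []
everyAux b zero (y ∷ ys) = y ∷ everyAux b (b ∸ 1) ys
everyAux b (suc c) (y ∷ ys) = everyAux b c ys

every : {A : Set} → ℕ → List A → List A
every b ys = everyAux b (b ∸ 1) ys

-- The constraint  a_1 x_1 + ... + a_k x_k ≤ a0  with k = n-1 variables,
-- coefficients a i and domains d i for 1 ≤ i ≤ k; the tare variable is
-- x_n with n = suc k, coefficient b^(m+1) - 1 - a0 and domain [0,1].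

module SNTare (sn : SNFun) (b m a0 k : ℕ) (a d : ℕ → ℕ) where

  n : ℕ
  n = suc k

  coef : ℕ → ℕ
  coef i = if i ≡ᵇ n then (b ^ suc m ∸ 1) ∸ a0 else a i

  dom : ℕ → ℕ
  dom i = if i ≡ᵇ n then 1 else d i

  A : ℕ → ℕ → ℕ
  A i j = digit b (coef i) j

  X : ℕ → ℕ → List Lit
  X i j = concatMap (λ t → replicate (A i j) (pos (ord i t))) (range1 (dom i))

  Xs : ℕ → List Lit
  Xs j = concatMap (λ i → X i j) (range1 n)

  nets : ℕ → List Var × CNF × ℕ
  nets zero = sn (Xs 0) 0
  nets (suc j) =
    let (ys , F , s) = nets j
        (zs , G , s') = sn (map pos (every b ys) ++ Xs (suc j)) s
    in zs , F ++ G , s'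

  orderClauses : CNF
  orderClauses = concatMap
    (λ i → map (λ t → neg (ord i (suc t)) ∷ pos (ord i t) ∷ [])
               (range1 (dom i ∸ 1)))
    (range1 n)

  finalUnits : CNF
  finalUnits =
    let (ys , F , s) = nets m
    in unit (pos (ord n 1)) ∷
       (Data.Maybe.maybe (λ y → unit (neg y) ∷ []) [] (at (b ∸ 1) ys))
    where import Data.Maybe

  encoding : CNF
  encoding =
    let (ys , F , s) = nets m
    in orderClauses ++ F ++ finalUnits

boundLits : (k : ℕ) (d l u : ℕ → ℕ) → List Lit
boundLits k d l u = concatMap
  (λ i → map (λ t → pos (ord i t)) (range1 (l i)) ++
         map (λ t → neg (ord i (suc (u i) + t))) (upTo (d i ∸ u i)))
  (range1 k)

-- Assert the lower bounds x_i ≥ l_i (and x_n ≥ 1 for the tare).  Since unit propagation is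
-- domain consistent on each sorting network, network j propagates its first c_j outputs to
-- true, where D_j = Σ_i A_{i,j} l_i counts its asserted inputs, c_0 = D_0 and
-- c_{j+1} = ⌊c_j / b⌋ + D_{j+1} (every b-th output of network j is an input of network j+1).
-- Carrying discards only the remainder c_j mod b < b, so by induction Σ_{i≤j} b^i D_i < (c_j + 1) b^j.
-- For j = m the left side is Σ_i a_i l_i + (b^{m+1} - 1 - a_0) ≥ b^{m+1} by infeasibility,
-- hence c_m ≥ b: the output y_m^b is propagated, contradicting the unit clause ¬y_m^b.
module Submission where

open import Defs
open import Data.Nat using (ℕ; zero; suc; _+_; _*_; _∸_; _^_; _≤_; _<_; _≡ᵇ_; z≤n; s≤s; z<s; NonZero; _≤′_; ≤′-refl; ≤′-step)
open import Data.Nat.Properties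
open import Data.Nat.DivMod using (_/_; _%_; m≡m%n+[m/n]*n; m%n<n; m/n*n≤m; m/n/o≡m/[n*o]; /-congʳ; n/1≡n; m<n⇒m/n≡0)
open import Data.Nat.ListAction using (sum)
open import Data.Nat.ListAction.Properties using (sum-++)
open import Data.Nat.Tactic.RingSolver using (solve-∀)
open import Algebra.Properties.CommutativeSemigroup +-commutativeSemigroup using (interchange)
open import Data.List using (List; []; _∷_; _++_; map; concatMap; replicate; applyUpTo; upTo; length; take)
open import Data.List.Properties using (length-++; length-map; length-replicate; length-applyUpTo; map-++; map-∘; map-cong; map-cong-local; applyUpTo-∷ʳ)
open import Data.List.Membership.Propositional using (_∈_)
open import Data.List.Membership.Propositional.Properties using (∈-++⁺ˡ; ∈-++⁺ʳ; ∈-++⁻; ∈-map⁺; ∈-upTo⁺; ∈-concat⁺′)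
open import Data.List.Relation.Unary.Any using (here; there)
open import Data.List.Relation.Unary.All as All using (All; []; _∷_)
open import Data.List.Relation.Unary.All.Properties using (++⁺; concat⁺; map⁺; replicate⁺; applyUpTo⁺₁)
open import Data.List.Relation.Binary.Subset.Propositional using (_⊆_)
open import Data.List.Relation.Binary.Subset.Propositional.Properties using (⊆-trans; xs⊆xs++ys; xs⊆ys++xs)
open import Data.List.Relation.Binary.Sublist.Propositional using ([]; _∷_; _∷ʳ_) renaming (_⊆_ to _⊑_; ⊆-refl to ⊑-refl; lookup to ⊑-lookup)
import Data.List.Relation.Binary.Sublist.Propositional.Properties as Sublist
open import Data.Bool using (true; if_then_else_)
open import Data.Maybe using (just; maybe)
open import Data.Product using (_×_; _,_; ∃-syntax; proj₁; proj₂)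
open import Data.Sum using (inj₁; inj₂)
open import Function using (id; _∘_)
open import Relation.Nullary using (contradiction)
open import Relation.Binary.PropositionalEquality

private variable
  S T : Set

units-∈ : ∀ {α : List Lit} {c l} → c ∈ units α → l ∈ c → l ∈ α
units-∈ {_ ∷ _} (here refl) (here refl) = here refl
units-∈ {_ ∷ _} (here refl) (there ())
units-∈ {_ ∷ _} (there c∈α) l∈c = there (units-∈ c∈α l∈c)

Derives-unit : ∀ {F l} → unit l ∈ F → Derives F l
Derives-unit l∈F = prop l∈F (here refl) λ where
  _ (here refl) l≢l → contradiction refl l≢l
  _ (there ()) _

Derives-cut : ∀ {G F α l} → G ⊆ F → All (Derives F) α → Derives (G ++ units α) l → Derives F l
Derives-cut {G} G⊆F dα (prop c∈ l∈c rest) with ∈-++⁻ G c∈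
... | inj₁ c∈G = prop (G⊆F c∈G) l∈c λ l′ l′∈c l′≢l → Derives-cut G⊆F dα (rest l′ l′∈c l′≢l)
... | inj₂ c∈α = All.lookup dα (units-∈ c∈α l∈c)

unit-conflict : ∀ {F l} → unit l ∈ F → Derives F (negate l) → Conflict F
unit-conflict {l = l} l∈F d = unit l , l∈F , λ where
  _ (here refl) → d
  _ (there ())

at-∈ : ∀ p {xs : List S} {x} → at p xs ≡ just x → x ∈ xs
at-∈ zero    {_ ∷ _} refl = here refl
at-∈ (suc p) {_ ∷ _} eq   = there (at-∈ p eq)

at-just : ∀ p (xs : List S) → p < length xs → ∃[ x ] at p xs ≡ just x
at-just zero    (x ∷ _)  _         = x , refl
at-just (suc p) (_ ∷ xs) (s≤s p<n) = at-just p xs p<n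

countTrue-⊑ : ∀ σ {xs ys} → xs ⊑ ys → SatLits σ xs → length xs ≤ countTrue σ ys
countTrue-⊑ σ []               _   = z≤n
countTrue-⊑ σ (y ∷ʳ xs⊑ys)     sat = ≤-trans (countTrue-⊑ σ xs⊑ys sat) (m≤n+m _ _)
countTrue-⊑ σ (refl ∷ xs⊑ys) sat rewrite sat _ (here refl) =
  s≤s (countTrue-⊑ σ xs⊑ys (λ l → sat l ∘ there))

PrefixDerived : CNF → ℕ → List Var → Set
PrefixDerived F c ws = ∀ p → p < c → ∃[ w ] (at p ws ≡ just w × Derives F (pos w))

module _ {sn : SNFun} (spec : SNSpec sn) where
  open SNSpec spec

  sn-prefixDerived : ∀ {F α} us s → AllPos us → let (ws , G , _) = sn us s in
    G ⊆ F → α ⊑ us → All (Derives F) α → PrefixDerived F (length α) ws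
  sn-prefixDerived {α = α} us s us-pos G⊆F α⊑us dα p p<α =
    w , at-w , Derives-cut G⊆F dα (dcPropagate us us-pos s α on-interface (pos w) (inj₂ (at-∈ p at-w)) forced)
    where
    ws : List Var
    ws = proj₁ (sn us s)
    p<ws : p < length ws
    p<ws = ≤-trans p<α (≤-trans (Sublist.length-mono-≤ α⊑us) (≤-reflexive (sym (outLength us us-pos s))))
    w : Var
    w = proj₁ (at-just p ws p<ws)
    at-w : at p ws ≡ just w
    at-w = proj₂ (at-just p ws p<ws)
    on-interface : ∀ l → l ∈ α → Interface us ws (litVar l)
    on-interface l l∈α = inj₁ (l , ⊑-lookup α⊑us l∈α , refl)
    forced : ∀ σ → SatLits σ α → SortRel us ws σ → evalLit σ (pos w) ≡ true
    forced σ sat sorted = proj₂ (sorted p w at-w) (≤-trans p<α (countTrue-⊑ σ α⊑us sat))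

at-everyAux : ∀ b′ c (ys : List S) q {y} → at (c + q * suc b′) ys ≡ just y → at q (everyAux (suc b′) c ys) ≡ just y
at-everyAux b′ c       []       q       ()
at-everyAux b′ zero    (_ ∷ _)  zero    eq = eq
at-everyAux b′ zero    (_ ∷ ys) (suc q) eq = at-everyAux b′ b′ ys q eq
at-everyAux b′ (suc c) (_ ∷ ys) q       eq = at-everyAux b′ c ys q eq

PrefixDerived-every : ∀ {F c} b′ ys → PrefixDerived F c ys → PrefixDerived F (c / suc b′) (every (suc b′) ys)
PrefixDerived-every {c = c} b′ ys derived q q<c/b =
  let w , at-w , dw = derived (b′ + q * suc b′) (≤-trans (*-monoˡ-≤ (suc b′) q<c/b) (m/n*n≤m c (suc b′)))
  in w , at-everyAux b′ b′ ys q at-w , dw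

PrefixDerived-take : ∀ {F} c ws → PrefixDerived F c ws →
  length (take c ws) ≡ c × All (Derives F ∘ pos) (take c ws)
PrefixDerived-take zero    ws       _ = refl , []
PrefixDerived-take (suc c) []       derived with derived 0 z<s
... | _ , () , _
PrefixDerived-take (suc c) (w ∷ ws) derived
  with derived 0 z<s | PrefixDerived-take c ws (λ p p<c → derived (suc p) (s≤s p<c))
... | _ , refl , dw | len , dws = cong suc len , dw ∷ dws

applyUpTo-⊑ : ∀ (f : ℕ → S) {p q} → p ≤ q → applyUpTo f p ⊑ applyUpTo f q
applyUpTo-⊑ f z≤n       = Sublist.[]⊆-universal _
applyUpTo-⊑ f (s≤s p≤q) = refl ∷ applyUpTo-⊑ (f ∘ suc) p≤q

range1-⊑ : ∀ {p q} → p ≤ q → range1 p ⊑ range1 q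
range1-⊑ p≤q = Sublist.map⁺ suc (applyUpTo-⊑ id p≤q)

∈-range1⁺ : ∀ {i p} → i < p → suc i ∈ range1 p
∈-range1⁺ i<p = ∈-map⁺ suc (∈-upTo⁺ i<p)

All-range1 : ∀ {P : ℕ → Set} p → (∀ {i} → i < p → P (suc i)) → All P (range1 p)
All-range1 p P-suc = map⁺ (applyUpTo⁺₁ id p P-suc)

length-range1 : ∀ p → length (range1 p) ≡ p
length-range1 p = trans (length-map suc (upTo p)) (length-applyUpTo id p)

concatMap-⊑ : ∀ {f g : S → List T} {xs ys} → xs ⊑ ys → All (λ y → f y ⊑ g y) ys →
  concatMap f xs ⊑ concatMap g ys
concatMap-⊑         []             []            = []
concatMap-⊑ {g = g} (y ∷ʳ xs⊑ys)   (_ ∷ f⊑g)     = Sublist.++⁺ˡ (g y) (concatMap-⊑ xs⊑ys f⊑g)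
concatMap-⊑         (refl ∷ xs⊑ys) (fy⊑gy ∷ f⊑g) = Sublist.++⁺ fy⊑gy (concatMap-⊑ xs⊑ys f⊑g)

length-concatMap : ∀ (f : S → List T) xs → length (concatMap f xs) ≡ sum (map (length ∘ f) xs)
length-concatMap f []       = refl
length-concatMap f (x ∷ xs) = trans (length-++ (f x)) (cong (length (f x) +_) (length-concatMap f xs))

sum-map-+ : ∀ (f g : S → ℕ) xs → sum (map (λ x → f x + g x) xs) ≡ sum (map f xs) + sum (map g xs)
sum-map-+ f g []       = refl
sum-map-+ f g (x ∷ xs) =
  trans (cong (f x + g x +_) (sum-map-+ f g xs)) (interchange (f x) (g x) (sum (map f xs)) (sum (map g xs)))

sum-map-*ˡ : ∀ c (f : S → ℕ) xs → sum (map (λ x → c * f x) xs) ≡ c * sum (map f xs)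
sum-map-*ˡ c f []       = sym (*-zeroʳ c)
sum-map-*ˡ c f (x ∷ xs) = trans (cong (c * f x +_) (sum-map-*ˡ c f xs)) (sym (*-distribˡ-+ c (f x) _))

sum-map-const : ∀ c (xs : List S) → sum (map (λ _ → c) xs) ≡ c * length xs
sum-map-const c []       = sym (*-zeroʳ c)
sum-map-const c (_ ∷ xs) = trans (cong (c +_) (sum-map-const c xs)) (sym (*-suc c (length xs)))

sum-map-swap : ∀ (f : S → T → ℕ) xs ys →
  sum (map (λ x → sum (map (f x) ys)) xs) ≡ sum (map (λ y → sum (map (λ x → f x y) xs)) ys)
sum-map-swap f []       ys = sym (sum-map-const 0 ys)
sum-map-swap f (x ∷ xs) ys =
  trans (cong (sum (map (f x) ys) +_) (sum-map-swap f xs ys)) (sym (sum-map-+ (f x) _ ys))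

sum-map-upTo-suc : ∀ (g : ℕ → ℕ) J → sum (map g (upTo (suc J))) ≡ sum (map g (upTo J)) + g J
sum-map-upTo-suc g J = begin
  sum (map g (upTo (suc J)))              ≡⟨ cong (sum ∘ map g) (applyUpTo-∷ʳ id J) ⟨
  sum (map g (upTo J ++ J ∷ []))          ≡⟨ cong sum (map-++ g (upTo J) (J ∷ [])) ⟩
  sum (map g (upTo J) ++ g J ∷ [])        ≡⟨ sum-++ (map g (upTo J)) (g J ∷ []) ⟩
  sum (map g (upTo J)) + (g J + 0)        ≡⟨ cong (sum (map g (upTo J)) +_) (+-identityʳ (g J)) ⟩
  sum (map g (upTo J)) + g J              ∎
  where open ≡-Reasoning

sumTo-suc : ∀ k f → sumTo (suc k) f ≡ sumTo k f + f (suc k)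
sumTo-suc k f = begin
  sum (map f (map suc (upTo (suc k))))     ≡⟨ cong sum (map-∘ (upTo (suc k))) ⟨
  sum (map (f ∘ suc) (upTo (suc k)))       ≡⟨ sum-map-upTo-suc (f ∘ suc) k ⟩
  sum (map (f ∘ suc) (upTo k)) + f (suc k) ≡⟨ cong (λ s → sum s + f (suc k)) (map-∘ (upTo k)) ⟩
  sumTo k f + f (suc k)                    ∎
  where open ≡-Reasoning

module _ (b′ : ℕ) where
  private
    b : ℕ
    b = suc b′
    _/b^_ : ℕ → ℕ → ℕ
    x /b^ J = (x / b ^ J) {{m^n≢0 b J}}

  digit-expansion : ∀ x J → sum (map (λ j → b ^ j * digit b x j) (upTo J)) + b ^ J * (x /b^ J) ≡ x
  digit-expansion x zero    = trans (*-identityˡ (x / 1)) (n/1≡n x)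
  digit-expansion x (suc J) = begin
    low (suc J) + b ^ suc J * (x /b^ suc J)       ≡⟨ cong₂ _+_ (sum-map-upTo-suc g J) (cong (b ^ suc J *_) x/b^[1+J]) ⟩
    low J + b ^ J * (Q % b) + b * b ^ J * (Q / b) ≡⟨ regroup (low J) (b ^ J) (Q % b) (Q / b) b ⟩
    low J + b ^ J * (Q % b + Q / b * b)           ≡⟨ cong (λ r → low J + b ^ J * r) (m≡m%n+[m/n]*n Q b) ⟨
    low J + b ^ J * Q                             ≡⟨ digit-expansion x J ⟩
    x                                             ∎
    where
    open ≡-Reasoning
    g : ℕ → ℕ
    g j = b ^ j * digit b x j
    low : ℕ → ℕ
    low J = sum (map g (upTo J))
    Q : ℕ
    Q = x /b^ J
    b^J*b≢0 : NonZero (b ^ J * b)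
    b^J*b≢0 = m*n≢0 (b ^ J) b {{m^n≢0 b J}}
    x/b^[1+J] : x /b^ suc J ≡ Q / b
    x/b^[1+J] = trans (/-congʳ {{m^n≢0 b (suc J)}} {{b^J*b≢0}} (*-comm b (b ^ J)))
                      (sym (m/n/o≡m/[n*o] x (b ^ J) b {{m^n≢0 b J}} {{_}} {{b^J*b≢0}}))
    regroup : ∀ s P r q c → s + P * r + c * P * q ≡ s + P * (r + q * c)
    regroup = solve-∀

  digits-sum : ∀ x J → x < b ^ J → sum (map (λ j → b ^ j * digit b x j) (upTo J)) ≡ x
  digits-sum x J x<b^J = begin
    s                     ≡⟨ +-identityʳ s ⟨
    s + 0                 ≡⟨ cong (s +_) (*-zeroʳ (b ^ J)) ⟨
    s + b ^ J * 0         ≡⟨ cong (λ q → s + b ^ J * q) (m<n⇒m/n≡0 {{m^n≢0 b J}} x<b^J) ⟨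
    s + b ^ J * (x /b^ J) ≡⟨ digit-expansion x J ⟩
    x                     ∎
    where
    open ≡-Reasoning
    s : ℕ
    s = sum (map (λ j → b ^ j * digit b x j) (upTo J))

  weighted-digits-sum : ∀ {I : Set} J (f w : I → ℕ) xs → All (λ i → f i < b ^ J) xs →
    sum (map (λ j → b ^ j * sum (map (λ i → digit b (f i) j * w i) xs)) (upTo J)) ≡ sum (map (λ i → w i * f i) xs)
  weighted-digits-sum {I} J f w xs f<b^J = begin
    sum (map (λ j → b ^ j * sum (map (λ i → digit b (f i) j * w i) xs)) (upTo J))
      ≡⟨ cong sum (map-cong (λ j → sym (sum-map-*ˡ (b ^ j) (λ i → digit b (f i) j * w i) xs)) (upTo J)) ⟩
    sum (map (λ j → sum (map (term j) xs)) (upTo J))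
      ≡⟨ sum-map-swap term (upTo J) xs ⟩
    sum (map (λ i → sum (map (λ j → term j i) (upTo J))) xs)
      ≡⟨ cong sum (map-cong-local (All.map (λ {i} → column i) f<b^J)) ⟩
    sum (map (λ i → w i * f i) xs) ∎
    where
    open ≡-Reasoning
    term : ℕ → I → ℕ
    term j i = b ^ j * (digit b (f i) j * w i)
    column : ∀ i → f i < b ^ J → sum (map (λ j → term j i) (upTo J)) ≡ w i * f i
    column i fi<b^J = begin
      sum (map (λ j → term j i) (upTo J))
        ≡⟨ cong sum (map-cong (λ j → trans (sym (*-assoc (b ^ j) _ (w i))) (*-comm _ (w i))) (upTo J)) ⟩
      sum (map (λ j → w i * (b ^ j * digit b (f i) j)) (upTo J))
        ≡⟨ sum-map-*ˡ (w i) _ (upTo J) ⟩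
      w i * sum (map (λ j → b ^ j * digit b (f i) j) (upTo J))
        ≡⟨ cong (w i *_) (digits-sum (f i) J fi<b^J) ⟩
      w i * f i ∎

1+m≤[1+m/n]*n : ∀ m n .{{_ : NonZero n}} → suc m ≤ suc (m / n) * n
1+m≤[1+m/n]*n m n = begin
  suc m                    ≡⟨ cong suc (m≡m%n+[m/n]*n m n) ⟩
  suc (m % n + m / n * n)  ≤⟨ +-monoˡ-≤ (m / n * n) (m%n<n m n) ⟩
  suc (m / n) * n          ∎
  where open ≤-Reasoning

module Carry (b : ℕ) .{{_ : NonZero b}} (D : ℕ → ℕ) where

  carried : ℕ → ℕ
  carried zero    = D zero
  carried (suc j) = carried j / b + D (suc j)

  weighted-sum<carried : ∀ j → sum (map (λ i → b ^ i * D i) (upTo (suc j))) < suc (carried j) * b ^ j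
  weighted-sum<carried zero    = ≤-reflexive (base (D 0))
    where
    base : ∀ x → suc (1 * x + 0) ≡ suc x * 1
    base = solve-∀
  weighted-sum<carried (suc j) = begin-strict
    Σ≤ (suc j)                                              ≡⟨ sum-map-upTo-suc (λ i → b ^ i * D i) (suc j) ⟩
    Σ≤ j + b ^ suc j * D (suc j)                            <⟨ +-monoˡ-< _ (weighted-sum<carried j) ⟩
    suc (carried j) * b ^ j + b ^ suc j * D (suc j)         ≤⟨ +-monoˡ-≤ _ (*-monoˡ-≤ (b ^ j) (1+m≤[1+m/n]*n (carried j) b)) ⟩
    suc (carried j / b) * b * b ^ j + b ^ suc j * D (suc j) ≡⟨ regroup (carried j / b) b (b ^ j) (D (suc j)) ⟩
    suc (carried (suc j)) * b ^ suc j                       ∎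
    where
    open ≤-Reasoning
    Σ≤ : ℕ → ℕ
    Σ≤ j = sum (map (λ i → b ^ i * D i) (upTo (suc j)))
    regroup : ∀ q c P d → suc q * c * P + c * P * d ≡ suc (q + d) * (c * P)
    regroup = solve-∀

if-≡ᵇ-refl : ∀ n {x y : S} → (if n ≡ᵇ n then x else y) ≡ x
if-≡ᵇ-refl zero    = refl
if-≡ᵇ-refl (suc n) = if-≡ᵇ-refl n

if-≡ᵇ-< : ∀ {i n} {x y : S} → i < n → (if i ≡ᵇ n then x else y) ≡ y
if-≡ᵇ-< {i = zero}  {suc n} _         = refl
if-≡ᵇ-< {i = suc i} {suc n} (s≤s i<n) = if-≡ᵇ-< i<n

module Consistency (sn : SNFun) (spec : SNSpec sn) (k : ℕ) (a d : ℕ → ℕ) (a0 b′ m : ℕ) (l u : ℕ → ℕ) where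

  b : ℕ
  b = suc b′

  open SNTare sn b m a0 k a d

  Φ : CNF
  Φ = encoding ++ units (boundLits k d l u)

  -- x_n ≥ 1 is asserted by the unit clause x_n^1 of the encoding
  lower : ℕ → ℕ
  lower i = if i ≡ᵇ n then 1 else l i

  Xlow : ℕ → ℕ → List Lit
  Xlow i j = concatMap (λ t → replicate (A i j) (pos (ord i t))) (range1 (lower i))

  Xslow : ℕ → List Lit
  Xslow j = concatMap (λ i → Xlow i j) (range1 n)

  open Carry b (length ∘ Xslow)

  outputs : ℕ → List Var
  outputs j = proj₁ (nets j)

  clauses : ℕ → CNF
  clauses j = proj₁ (proj₂ (nets j))

  clauses-mono : ∀ {i j} → i ≤′ j → clauses i ⊆ clauses j
  clauses-mono ≤′-refl       = id
  clauses-mono (≤′-step i≤j) = xs⊆xs++ys _ _ ∘ clauses-mono i≤j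

  clauses-⊆ : ∀ {j} → j ≤ m → clauses j ⊆ Φ
  clauses-⊆ j≤m = xs⊆xs++ys _ _ ∘ xs⊆ys++xs _ orderClauses ∘ xs⊆xs++ys _ _ ∘ clauses-mono (≤⇒≤′ j≤m)

  Positive : Lit → Set
  Positive l = ∃[ v ] l ≡ pos v

  Xs-positive : ∀ j → All Positive (Xs j)
  Xs-positive j = concat⁺ (map⁺ (All.universal (λ i →
    concat⁺ (map⁺ (All.universal (λ t → replicate⁺ (A i j) (ord i t , refl)) (range1 (dom i))))) (range1 n)))

  input-positive : ∀ j → AllPos (map pos (every b (outputs j)) ++ Xs (suc j))
  input-positive j _ = All.lookup (++⁺ (map⁺ (All.universal (λ v → v , refl) (every b (outputs j)))) (Xs-positive (suc j)))

  bound-derived : ∀ {i t} → i < k → t < l (suc i) → Derives Φ (pos (ord (suc i) (suc t)))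
  bound-derived {i} {t} i<k t<l = Derives-unit (∈-++⁺ʳ encoding (∈-map⁺ unit (∈-concat⁺′ t∈ (∈-map⁺ bounds (∈-range1⁺ i<k)))))
    where
    bounds : ℕ → List Lit
    bounds i = map (λ t → pos (ord i t)) (range1 (l i)) ++ map (λ t → neg (ord i (suc (u i) + t))) (upTo (d i ∸ u i))
    t∈ : pos (ord (suc i) (suc t)) ∈ bounds (suc i)
    t∈ = ∈-++⁺ˡ (∈-map⁺ (λ t → pos (ord (suc i) t)) (∈-range1⁺ t<l))

  tare-derived : Derives Φ (pos (ord n 1))
  tare-derived = Derives-unit (∈-++⁺ˡ (∈-++⁺ʳ orderClauses (∈-++⁺ʳ (clauses m) (here refl))))

  lower-derived : ∀ {i t} → i < n → t < lower (suc i) → Derives Φ (pos (ord (suc i) (suc t)))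
  lower-derived i<n t<lower with m<1+n⇒m<n∨m≡n i<n
  ... | inj₁ i<k  = bound-derived i<k (subst (_ <_) (if-≡ᵇ-< (s≤s i<k)) t<lower)
  ... | inj₂ refl with subst (_ <_) (if-≡ᵇ-refl n) t<lower
  ...   | s≤s z≤n = tare-derived

  Xslow-derived : ∀ j → All (Derives Φ) (Xslow j)
  Xslow-derived j = concat⁺ (map⁺ (All-range1 n λ i<n →
    concat⁺ (map⁺ (All-range1 _ λ t<lower → replicate⁺ _ (lower-derived i<n t<lower)))))

  module _ (l≤d : ∀ i → 1 ≤ i → i ≤ k → l i ≤ d i) where

    lower≤dom : ∀ {i} → i < n → lower (suc i) ≤ dom (suc i)
    lower≤dom i<n with m<1+n⇒m<n∨m≡n i<n
    ... | inj₁ i<k  = subst₂ _≤_ (sym (if-≡ᵇ-< (s≤s i<k))) (sym (if-≡ᵇ-< (s≤s i<k))) (l≤d _ (s≤s z≤n) i<k)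
    ... | inj₂ refl = subst₂ _≤_ (sym (if-≡ᵇ-refl n)) (sym (if-≡ᵇ-refl n)) ≤-refl

    Xslow-⊑ : ∀ j → Xslow j ⊑ Xs j
    Xslow-⊑ j = concatMap-⊑ ⊑-refl (All-range1 n λ i<n →
      concatMap-⊑ (range1-⊑ (lower≤dom i<n)) (All.universal (λ _ → ⊑-refl) _))

    outputs-derived : ∀ j → j ≤ m → PrefixDerived Φ (carried j) (outputs j)
    outputs-derived zero    0≤m =
      sn-prefixDerived spec (Xs 0) 0 (λ _ → All.lookup (Xs-positive 0)) (clauses-⊆ 0≤m) (Xslow-⊑ 0) (Xslow-derived 0)
    outputs-derived (suc j) j<m =
      subst (λ c → PrefixDerived Φ c (outputs (suc j))) length-input
        (sn-prefixDerived spec (map pos (every b (outputs j)) ++ Xs (suc j)) (proj₂ (proj₂ (nets j)))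
          (input-positive j) (⊆-trans (xs⊆ys++xs _ (clauses j)) (clauses-⊆ j<m))
          (Sublist.++⁺ (Sublist.map⁺ pos (Sublist.take-⊆ (carried j / b) (every b (outputs j)))) (Xslow-⊑ (suc j)))
          (++⁺ (map⁺ (proj₂ carries-derived)) (Xslow-derived (suc j))))
      where
      carries : List Var
      carries = take (carried j / b) (every b (outputs j))
      carries-derived : length carries ≡ carried j / b × All (Derives Φ ∘ pos) carries
      carries-derived = PrefixDerived-take (carried j / b) (every b (outputs j))
        (PrefixDerived-every b′ (outputs j) (outputs-derived j (<⇒≤ j<m)))
      length-input : length (map pos carries ++ Xslow (suc j)) ≡ carried (suc j)
      length-input = trans (length-++ (map pos carries))
        (cong (_+ length (Xslow (suc j))) (trans (length-map pos carries) (proj₁ carries-derived)))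

  length-Xslow : ∀ j → length (Xslow j) ≡ sumTo n (λ i → A i j * lower i)
  length-Xslow j = trans (length-concatMap (λ i → Xlow i j) (range1 n)) (cong sum (map-cong length-Xlow (range1 n)))
    where
    length-Xlow : ∀ i → length (Xlow i j) ≡ A i j * lower i
    length-Xlow i = begin
      length (Xlow i j)
        ≡⟨ length-concatMap (λ t → replicate (A i j) (pos (ord i t))) (range1 (lower i)) ⟩
      sum (map (λ t → length (replicate (A i j) (pos (ord i t)))) (range1 (lower i)))
        ≡⟨ cong sum (map-cong (λ _ → length-replicate (A i j)) (range1 (lower i))) ⟩
      sum (map (λ _ → A i j) (range1 (lower i)))
        ≡⟨ sum-map-const (A i j) (range1 (lower i)) ⟩
      A i j * length (range1 (lower i))
        ≡⟨ cong (A i j *_) (length-range1 (lower i)) ⟩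
      A i j * lower i ∎
      where open ≡-Reasoning

  tare : ℕ
  tare = (b ^ suc m ∸ 1) ∸ a0

  coef<b^[1+m] : (∀ i → 1 ≤ i → i ≤ k → a i < b ^ suc m) → ∀ {i} → i < n → coef (suc i) < b ^ suc m
  coef<b^[1+m] a< i<n with m<1+n⇒m<n∨m≡n i<n
  ... | inj₁ i<k  = subst (_< b ^ suc m) (sym (if-≡ᵇ-< (s≤s i<k))) (a< _ (s≤s z≤n) i<k)
  ... | inj₂ refl = subst (_< b ^ suc m) (sym (if-≡ᵇ-refl n))
    (≤-<-trans (m∸n≤m _ a0) (∸-monoʳ-< z<s (m^n>0 b (suc m))))

  weighted-length-sum : (∀ i → 1 ≤ i → i ≤ k → a i < b ^ suc m) →
    sum (map (λ j → b ^ j * length (Xslow j)) (upTo (suc m))) ≡ sumTo n (λ i → lower i * coef i)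
  weighted-length-sum a< =
    trans (cong sum (map-cong (λ j → cong (b ^ j *_) (length-Xslow j)) (upTo (suc m))))
          (weighted-digits-sum b′ (suc m) coef lower (range1 n) (All-range1 n (coef<b^[1+m] a<)))

  b^[1+m]≤Σlower*coef : a0 < b ^ suc m → a0 < sumTo k (λ i → a i * l i) → b ^ suc m ≤ sumTo n (λ i → lower i * coef i)
  b^[1+m]≤Σlower*coef a0<b^[1+m] infeasible = begin
    b ^ suc m                                           ≡⟨ m+[n∸m]≡n a0<b^[1+m] ⟨
    suc a0 + (b ^ suc m ∸ suc a0)                       ≡⟨ cong (suc a0 +_) (∸-+-assoc (b ^ suc m) 1 a0) ⟨
    suc a0 + tare                                       ≤⟨ +-monoˡ-≤ tare infeasible ⟩
    sumTo k (λ i → a i * l i) + tare                    ≡⟨ cong₂ _+_ bounded-part tare-part ⟩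
    sumTo k (λ i → lower i * coef i) + lower n * coef n ≡⟨ sumTo-suc k (λ i → lower i * coef i) ⟨
    sumTo n (λ i → lower i * coef i)                    ∎
    where
    open ≤-Reasoning
    bounded-part : sumTo k (λ i → a i * l i) ≡ sumTo k (λ i → lower i * coef i)
    bounded-part = cong sum (map-cong-local (All-range1 k λ {i} i<k →
      trans (*-comm (a (suc i)) (l (suc i))) (sym (cong₂ _*_ (if-≡ᵇ-< (s≤s i<k)) (if-≡ᵇ-< (s≤s i<k))))))
    tare-part : tare ≡ lower n * coef n
    tare-part = sym (trans (cong₂ _*_ (if-≡ᵇ-refl n) (if-≡ᵇ-refl n)) (*-identityˡ tare))

  b≤carried : (∀ i → 1 ≤ i → i ≤ k → a i < b ^ suc m) → a0 < b ^ suc m → a0 < sumTo k (λ i → a i * l i) →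
    b ≤ carried m
  b≤carried a< a0<b^[1+m] infeasible = ≤-pred (*-cancelʳ-< (b ^ m) b (suc (carried m)) (begin-strict
    b ^ suc m                                                  ≤⟨ b^[1+m]≤Σlower*coef a0<b^[1+m] infeasible ⟩
    sumTo n (λ i → lower i * coef i)                           ≡⟨ weighted-length-sum a< ⟨
    sum (map (λ j → b ^ j * length (Xslow j)) (upTo (suc m)))  <⟨ weighted-sum<carried m ⟩
    suc (carried m) * b ^ m                                    ∎))
    where open ≤-Reasoning

  negated-output-∈ : ∀ {y} → at b′ (outputs m) ≡ just y → unit (neg y) ∈ Φ
  negated-output-∈ {y} at-y = ∈-++⁺ˡ (∈-++⁺ʳ orderClauses (∈-++⁺ʳ (clauses m) (there (unit-∈-maybe at-y))))
    where
    unit-∈-maybe : ∀ {my} → my ≡ just y → unit (neg y) ∈ maybe (λ w → unit (neg w) ∷ []) [] my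
    unit-∈-maybe refl = here refl

  conflict : (∀ i → 1 ≤ i → i ≤ k → l i ≤ d i) → (∀ i → 1 ≤ i → i ≤ k → a i < b ^ suc m) → a0 < b ^ suc m →
    a0 < sumTo k (λ i → a i * l i) → Conflict Φ
  conflict l≤d a< a0<b^[1+m] infeasible =
    let y , at-y , y-derived = outputs-derived l≤d m ≤-refl b′ (b≤carried a< a0<b^[1+m] infeasible)
    in unit-conflict (negated-output-∈ at-y) y-derived

theorem8 : (sn : SNFun) → SNSpec sn →
    (k : ℕ) (a d : ℕ → ℕ) (a0 b m : ℕ) →
    (∀ i → 1 ≤ i → i ≤ k → 1 ≤ a i) →
    2 ≤ b →
    a0 < b ^ suc m →
    (∀ m' → m' < m → b ^ suc m' ≤ a0) →
    (∀ i → 1 ≤ i → i ≤ k → a i < b ^ suc m) →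
    (l u : ℕ → ℕ) →
    (∀ i → 1 ≤ i → i ≤ k → l i ≤ u i) →
    (∀ i → 1 ≤ i → i ≤ k → u i ≤ d i) →
    (∀ (w : ℕ → ℕ) → (∀ i → 1 ≤ i → i ≤ k → l i ≤ w i) →
       (∀ i → 1 ≤ i → i ≤ k → w i ≤ u i) →
       a0 < sumTo k (λ i → a i * w i)) →
    Conflict (SNTare.encoding sn b m a0 k a d ++ units (boundLits k d l u))
theorem8 sn spec k a d a0 (suc b′) m _ (s≤s _) a0<b^[1+m] _ a< l u l≤u u≤d infeasible =
  Consistency.conflict sn spec k a d a0 b′ m l u
    (λ i 1≤i i≤k → ≤-trans (l≤u i 1≤i i≤k) (u≤d i 1≤i i≤k))
    a< a0<b^[1+m] (infeasible l (λ _ _ _ → ≤-refl) l≤u)
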